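{- Let $\beta$ be a positive integer and let $\varphi$ be the modified CFLS coloring on $V=\{0,1\}^{\beta^2}$. If $a,b,c\in V$ satisfy $a<b<c$, then $\varphi(a,b)\neq\varphi(b,c)$.
   Context: Let $\beta$ be a positive integer and $V=\{0,1\}^{\beta^2}$. For $v\in V$ write $v=(v^{(1)},\ldots,v^{(\beta)})$ where each block $v^{(i)}\in\{0,1\}^\beta$ consists of consecutive bits of $v$. The CFLS coloring is defined, for distinct $x,y\in V$, by $\varphi_1(x,y)=\big((i,\{x^{(i)},y^{(i)}\}), i_1,\ldots,i_\beta\big)$, where $i$ is the first index with $x^{(i)}\neq y^{(i)}$, and for each $k$, $i_k=0$ if $x^{(k)}=y^{(k)}$ and otherwise $i_k$ is the first position at which a bit of $x^{(k)}$ differs from the corresponding bit of $y^{(k)}$. Order $V$ (and likewise each set of blocks $\{0,1\}^\beta$) by regarding each string as the binary representation of an integer: $x<y$ iff at the first bit where $x$ and $y$ differ, $x$ has $0$ and $y$ has $1$. For $x<y$ define $\varphi_2(x,y)=(\delta_1(x,y),\ldots,\delta_\beta(x,y))$, where $\delta_i(x,y)=-1$ if $x^{(i)}>y^{(i)}$ and $\delta_i(x,y)=+1$ if $x^{(i)}\le y^{(i)}$; the color of the edge $\{x,y\}$ is $\varphi_2(\min,\max)$. The modified CFLS coloring is $\varphi(x,y)=(\varphi_1(x,y),\varphi_2(x,y))$. -}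

module Defs where

open import Data.Bool using (Bool; true; false; if_then_else_; not; _∧_; _∨_)
open import Data.Bool.Properties using () renaming (_≟_ to _≟B_)
open import Data.Nat using (ℕ; zero; suc; _*_)
open import Data.Fin using (Fin; toℕ; combine)
import Data.Fin as F
open import Data.Vec using (Vec; []; _∷_; lookup; tabulate)
open import Data.Vec.Properties using (≡-dec)
open import Data.Maybe using (Maybe; just; nothing)
open import Data.Product using (_×_; _,_)
open import Data.Integer using (ℤ; +_; -[1+_])
open import Relation.Nullary using (yes; no)
open import Relation.Binary.PropositionalEquality using (_≡_)

-- V = {0,1}^(β²): bit strings of length β*β (false = 0, true = 1).
V : ℕ → Set
V β = Vec Bool (β * β)

-- Block k of v: the β consecutive bits at positions kβ, …, kβ+β-1.
block : ∀ {β} → V β → Fin β → Vec Bool β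
block {β} v k = tabulate (λ j → lookup v (combine k j))

-- Lexicographic ("binary integer") strict order:
-- x < y iff at the first bit where they differ, x has 0 and y has 1.
ltB : ∀ {n} → Vec Bool n → Vec Bool n → Bool
ltB [] [] = false
ltB (a ∷ x) (b ∷ y) with a ≟B b
... | yes _ = ltB x y
... | no  _ = not a ∧ b

_<V_ : ∀ {n} → Vec Bool n → Vec Bool n → Set
x <V y = ltB x y ≡ true

firstDiff : ∀ {n} → Vec Bool n → Vec Bool n → Maybe (Fin n)
firstDiff [] [] = nothing
firstDiff (a ∷ x) (b ∷ y) with a ≟B b
... | no  _ = just F.zero
... | yes _ with firstDiff x y
...   | just i  = just (F.suc i)
...   | nothing = nothing

firstBlockDiff : ∀ {β} → V β → V β → Maybe (Fin β)
firstBlockDiff {β} x y = go (tabulate (block x)) (tabulate (block y))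
  where
  go : ∀ {m} → Vec (Vec Bool β) m → Vec (Vec Bool β) m → Maybe (Fin m)
  go [] [] = nothing
  go (a ∷ as) (b ∷ bs) with ≡-dec _≟B_ a b
  ... | no  _ = just F.zero
  ... | yes _ with go as bs
  ...   | just i  = just (F.suc i)
  ...   | nothing = nothing

-- The unordered pair {u, w} of blocks, represented canonically as
-- (smaller, larger) with respect to the order on {0,1}^β.
UPair : ℕ → Set
UPair β = Vec Bool β × Vec Bool β

upair : ∀ {β} → Vec Bool β → Vec Bool β → UPair β
upair u w = if ltB u w then (u , w) else (w , u)

-- i_k : 0 if blocks equal, otherwise the (1-based) first differing position.
posIndex : ∀ {β} → Vec Bool β → Vec Bool β → ℕ
posIndex u w with firstDiff u w
... | nothing = 0
... | just j  = suc (toℕ j)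

-- φ₁(x,y) = ((i, {x^(i), y^(i)}), i_1, …, i_β)
Color₁ : ℕ → Set
Color₁ β = Maybe (Fin β × UPair β) × Vec ℕ β

φ₁ : ∀ {β} → V β → V β → Color₁ β
φ₁ {β} x y = head , tabulate (λ k → posIndex (block x k) (block y k))
  where
  head : Maybe (Fin β × UPair β)
  head with firstBlockDiff x y
  ... | nothing = nothing
  ... | just i  = just (i , upair (block x i) (block y i))

δ : ∀ {β} → V β → V β → Fin β → ℤ
δ x y i = if ltB (block y i) (block x i) then -[1+ 0 ] else + 1

-- φ₂ applied to an ordered pair (x, y) (intended with x < y)
φ₂ : ∀ {β} → V β → V β → Vec ℤ β
φ₂ x y = tabulate (δ x y)

φ₂-edge : ∀ {β} → V β → V β → Vec ℤ β
φ₂-edge x y = if ltB x y then φ₂ x y else φ₂ y x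

Color : ℕ → Set
Color β = Color₁ β × Vec ℤ β

φ : (β : ℕ) → V β → V β → Color β
φ β x y = φ₁ x y , φ₂-edge x y

-- Let p be the first bit at which a and b differ, lying at position j of block i.  Then the
-- blocks a⁽ⁱ⁾ and b⁽ⁱ⁾ first differ at position j, with a⁽ⁱ⁾ⱼ = 0 and b⁽ⁱ⁾ⱼ = 1.  Equal φ₁-colours
-- force b⁽ⁱ⁾ and c⁽ⁱ⁾ to first differ at position j as well, so c⁽ⁱ⁾ⱼ = 0.  Hence a⁽ⁱ⁾ < b⁽ⁱ⁾
-- and c⁽ⁱ⁾ < b⁽ⁱ⁾, i.e. δᵢ(a,b) = +1 while δᵢ(b,c) = −1, so the φ₂-colours differ.
module Submission where

open import Defs
open import Data.Bool using (Bool; true; false; not; _∧_; if_then_else_)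
open import Data.Bool.Properties using (¬-not) renaming (_≟_ to _≟B_)
open import Data.Nat using (ℕ; suc; _*_; _≤_; _<_; s≤s; z≤n)
open import Data.Nat.Properties using (suc-injective; +-monoʳ-<)
open import Data.Fin using (Fin; toℕ; combine; remQuot)
import Data.Fin as F
open import Data.Fin.Properties using (toℕ-injective; combine-remQuot; toℕ-combine)
open import Data.Vec using (Vec; []; _∷_; lookup; tabulate)
open import Data.Vec.Properties using (lookup∘tabulate)
open import Data.Maybe using (just; nothing)
open import Data.Integer using (ℤ; +_; -[1+_])
open import Data.Product using (Σ-syntax; _×_; _,_; proj₁; proj₂)
open import Relation.Nullary using (¬_; yes; no; contradiction)
open import Relation.Binary.PropositionalEquality
  using (_≡_; _≢_; refl; sym; trans; cong; subst; module ≡-Reasoning)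

record AgreeBelow {n : ℕ} (x y : Vec Bool n) (j : Fin n) : Set where
  constructor agreeBelow
  field agree : ∀ q → toℕ q < toℕ j → lookup x q ≡ lookup y q

open AgreeBelow

module _ {n : ℕ} {x y : Vec Bool n} where

  agreeBelow-sym : {j : Fin n} → AgreeBelow x y j → AgreeBelow y x j
  agreeBelow-sym x≈y = agreeBelow λ q q<j → sym (agree x≈y q q<j)

  agreeBelow-∷ : ∀ {a b} {j : Fin n} → a ≡ b → AgreeBelow x y j → AgreeBelow (a ∷ x) (b ∷ y) (F.suc j)
  agreeBelow-∷ a≡b x≈y = agreeBelow λ where
    F.zero    _         → a≡b
    (F.suc q) (s≤s q<j) → agree x≈y q q<j

  agreeBelow-tail : ∀ {a b} {j : Fin n} → AgreeBelow (a ∷ x) (b ∷ y) (F.suc j) → AgreeBelow x y j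
  agreeBelow-tail ax≈by = agreeBelow λ q q<j → agree ax≈by (F.suc q) (s≤s q<j)

  agreeBelow-head : ∀ {a b} {j : Fin n} → AgreeBelow (a ∷ x) (b ∷ y) (F.suc j) → a ≡ b
  agreeBelow-head ax≈by = agree ax≈by F.zero (s≤s z≤n)

<V⇒firstBitDiff : ∀ {n} (x y : Vec Bool n) → x <V y →
                  Σ[ j ∈ Fin n ] AgreeBelow x y j × lookup x j ≡ false × lookup y j ≡ true
<V⇒firstBitDiff []      []      ()
<V⇒firstBitDiff (a ∷ x) (b ∷ y) x<y with a ≟B b
... | yes a≡b = let j , x≈y , xj , yj = <V⇒firstBitDiff x y x<y
                in F.suc j , agreeBelow-∷ a≡b x≈y , xj , yj
<V⇒firstBitDiff (false ∷ x) (true ∷ y) _ | no _ = F.zero , agreeBelow (λ _ ()) , refl , refl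

firstDiff-complete : ∀ {n} (x y : Vec Bool n) {j : Fin n} →
                     AgreeBelow x y j → lookup x j ≢ lookup y j → firstDiff x y ≡ just j
firstDiff-complete (a ∷ x) (b ∷ y) {j} x≈y xj≢yj with a ≟B b | j
... | yes a≡b | F.zero  = contradiction a≡b xj≢yj
... | no  _   | F.zero  = refl
... | no  a≢b | F.suc _ = contradiction (agreeBelow-head x≈y) a≢b
... | yes _   | F.suc j
  rewrite firstDiff-complete x y (agreeBelow-tail x≈y) xj≢yj = refl

firstDiff-sound : ∀ {n} (x y : Vec Bool n) {j : Fin n} →
                  firstDiff x y ≡ just j → AgreeBelow x y j × lookup x j ≢ lookup y j
firstDiff-sound (a ∷ x) (b ∷ y) eq with a ≟B b
firstDiff-sound (a ∷ x) (b ∷ y) refl | no a≢b = agreeBelow (λ _ ()) , a≢b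
... | yes a≡b with firstDiff x y in fd
firstDiff-sound (a ∷ x) (b ∷ y) refl | yes a≡b | just j =
  let x≈y , xj≢yj = firstDiff-sound x y fd in agreeBelow-∷ a≡b x≈y , xj≢yj

ltB-firstBitDiff : ∀ {n} (x y : Vec Bool n) {j : Fin n} → AgreeBelow x y j →
                   lookup x j ≢ lookup y j → ltB x y ≡ not (lookup x j) ∧ lookup y j
ltB-firstBitDiff (a ∷ x) (b ∷ y) {j} x≈y xj≢yj with a ≟B b | j
... | yes a≡b | F.zero  = contradiction a≡b xj≢yj
... | no  _   | F.zero  = refl
... | no  a≢b | F.suc _ = contradiction (agreeBelow-head x≈y) a≢b
... | yes _   | F.suc j = ltB-firstBitDiff x y (agreeBelow-tail x≈y) xj≢yj

posIndex-injective : ∀ {n} (u w u′ w′ : Vec Bool n) →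
                     posIndex u w ≡ posIndex u′ w′ → firstDiff u w ≡ firstDiff u′ w′
posIndex-injective u w u′ w′ eq with firstDiff u w | firstDiff u′ w′
... | nothing | nothing = refl
... | just j  | just j′ = cong just (toℕ-injective (suc-injective eq))

-- wⱼ ≠ vⱼ = 1 forces wⱼ = 0, so v is above both of its neighbours.
below-both-sides : ∀ {n} (u v w : Vec Bool n) {j : Fin n} →
                   AgreeBelow u v j → lookup u j ≡ false → lookup v j ≡ true →
                   firstDiff u v ≡ firstDiff v w → ltB v u ≡ false × ltB w v ≡ true
below-both-sides u v w {j} u≈v uj vj sameDiff = v≮u , w<v
  where
  uj≢vj : lookup u j ≢ lookup v j
  uj≢vj uj≡vj = contradiction (trans (sym uj) (trans uj≡vj vj)) (λ ())

  v≈w×vj≢wj : AgreeBelow v w j × lookup v j ≢ lookup w j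
  v≈w×vj≢wj = firstDiff-sound v w (trans (sym sameDiff) (firstDiff-complete u v u≈v uj≢vj))

  wj≢vj : lookup w j ≢ lookup v j
  wj≢vj wj≡vj = proj₂ v≈w×vj≢wj (sym wj≡vj)

  wj : lookup w j ≡ false
  wj = trans (¬-not wj≢vj) (cong not vj)

  v≮u : ltB v u ≡ false
  v≮u rewrite ltB-firstBitDiff v u (agreeBelow-sym u≈v) (λ e → uj≢vj (sym e)) | uj | vj = refl

  w<v : ltB w v ≡ true
  w<v rewrite ltB-firstBitDiff w v (agreeBelow-sym (proj₁ v≈w×vj≢wj)) wj≢vj | wj | vj = refl

module _ {β : ℕ} where

  lookup-block : (v : V β) (i j : Fin β) → lookup (block v i) j ≡ lookup v (combine i j)
  lookup-block v i j = lookup∘tabulate (λ j → lookup v (combine i j)) j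

  agreeBelow-block : {x y : V β} (i j : Fin β) →
                     AgreeBelow x y (combine i j) → AgreeBelow (block x i) (block y i) j
  agreeBelow-block {x} {y} i j x≈y = agreeBelow λ q q<j → begin
    lookup (block x i) q   ≡⟨ lookup-block x i q ⟩
    lookup x (combine i q) ≡⟨ agree x≈y (combine i q) (combine-monoʳ-< q<j) ⟩
    lookup y (combine i q) ≡⟨ lookup-block y i q ⟨
    lookup (block y i) q   ∎
    where
    open ≡-Reasoning
    combine-monoʳ-< : {q : Fin β} → toℕ q < toℕ j → toℕ (combine i q) < toℕ (combine i j)
    combine-monoʳ-< {q} q<j rewrite toℕ-combine i q | toℕ-combine i j = +-monoʳ-< _ q<j

  <V⇒firstBlockBitDiff : (x y : V β) → x <V y →
    Σ[ i ∈ Fin β ] Σ[ j ∈ Fin β ] AgreeBelow (block x i) (block y i) j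
                                 × lookup (block x i) j ≡ false × lookup (block y i) j ≡ true
  <V⇒firstBlockBitDiff x y x<y =
    let p , diffAtp = <V⇒firstBitDiff x y x<y
        i , j = remQuot β p
        x≈y , xj , yj = subst BitDiffAt (sym (combine-remQuot {β} β p)) diffAtp
    in i , j , agreeBelow-block i j x≈y , trans (lookup-block x i j) xj , trans (lookup-block y i j) yj
    where
    BitDiffAt : Fin (β * β) → Set
    BitDiffAt p = AgreeBelow x y p × lookup x p ≡ false × lookup y p ≡ true

  posIndex-block-≡ : (a b c : V β) → φ β a b ≡ φ β b c → (k : Fin β) →
                     posIndex (block a k) (block b k) ≡ posIndex (block b k) (block c k)
  posIndex-block-≡ a b c φ≡ k = begin
    posIndex (block a k) (block b k) ≡⟨ lookup∘tabulate (posIndexOfBlocks a b) k ⟨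
    lookup (proj₂ (φ₁ a b)) k        ≡⟨ cong (λ col → lookup (proj₂ (proj₁ col)) k) φ≡ ⟩
    lookup (proj₂ (φ₁ b c)) k        ≡⟨ lookup∘tabulate (posIndexOfBlocks b c) k ⟩
    posIndex (block b k) (block c k) ∎
    where
    open ≡-Reasoning
    posIndexOfBlocks : V β → V β → Fin β → ℕ
    posIndexOfBlocks x y k = posIndex (block x k) (block y k)

  φ₂-edge-ordered : (x y : V β) → x <V y → φ₂-edge {β} x y ≡ φ₂ x y
  φ₂-edge-ordered x y x<y rewrite x<y = refl

  δ-≡ : (a b c : V β) → a <V b → b <V c → φ β a b ≡ φ β b c → (k : Fin β) → δ a b k ≡ δ b c k
  δ-≡ a b c a<b b<c φ≡ k = begin
    δ a b k                ≡⟨ lookup∘tabulate (δ a b) k ⟨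
    lookup (φ₂ {β} a b) k  ≡⟨ cong (λ v → lookup v k) (φ₂-edge-ordered a b a<b) ⟨
    lookup (φ₂-edge {β} a b) k ≡⟨ cong (λ col → lookup (proj₂ col) k) φ≡ ⟩
    lookup (φ₂-edge {β} b c) k ≡⟨ cong (λ v → lookup v k) (φ₂-edge-ordered b c b<c) ⟩
    lookup (φ₂ {β} b c) k  ≡⟨ lookup∘tabulate (δ b c) k ⟩
    δ b c k                ∎
    where open ≡-Reasoning

mainTheorem8 : (β : ℕ) → 1 ≤ β → (a b c : V β) →
    a <V b → b <V c → ¬ (φ β a b ≡ φ β b c)
mainTheorem8 β _ a b c a<b b<c φ≡ =
  let i , j , a≈b , aj , bj = <V⇒firstBlockBitDiff a b a<b
      A = block a i; B = block b i; C = block c i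
      b≮a , c<b = below-both-sides A B C a≈b aj bj
                    (posIndex-injective A B B C (posIndex-block-≡ a b c φ≡ i))
  in contradiction (begin
       + 1           ≡⟨ cong sign b≮a ⟨
       δ {β} a b i   ≡⟨ δ-≡ a b c a<b b<c φ≡ i ⟩
       δ {β} b c i   ≡⟨ cong sign c<b ⟩
       -[1+ 0 ]      ∎) λ ()
  where
  open ≡-Reasoning
  sign : Bool → ℤ
  sign descending = if descending then -[1+ 0 ] else + 1
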